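{- Let $\mathbb{T}$ be a completely ordered monad with a binary continuous operation $\oplus$, and $B$ an observation pattern over $A$. Let $h:X\to Y$ be a morphism of coalgebras from $(X,f:X\to T(X\times A))$ to $(Y,g:Y\to T(Y\times A))$ (i.e. $g\circ h=T(h\times\mathrm{id}_A)\circ f$). Then $\mathrm{Ker}\,h\subseteq\mathrm{Ker}\,f^B_h$.
   Context: Monads are Kleisli triples $(T,\eta,(-)^\dagger)$, $Tv=(\eta\circ v)^\dagger$. Completely ordered: each set of maps $X\to TY$ is a directed-complete partial order with least element and Kleisli composition preserves directed joins in each argument. Continuous operation: natural transformation $(T-)^2\to T-$ with Scott-continuous components. Observation pattern: $B\subseteq\mathcal{P}(A^*)$ with $b/a=\{w\mid aw\in b\}\in B$ for $b\in B,a\in A$. For $h:X\to Y$, $f^B_h:X\to(TY)^B$ is the least map (pointwise order) satisfying $f^B_h(x)(b)=e_b(x)\oplus(\lambda(y,a).f^B_h(y)(b/a))^\dagger(f(x))$, where $e_b(x)=\eta_Y(h(x))$ if $\epsilon\in b$ and $\bot$ otherwise. $\mathrm{Ker}\,k=\{(x,x')\mid k(x)=k(x')\}$. -}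

module Defs where

open import Data.Bool using (Bool; if_then_else_)
open import Data.List using (List; []; _∷_)
open import Data.Product using (Σ; _×_; _,_; proj₁; proj₂; uncurry)
open import Function using (_∘_)
open import Relation.Binary.PropositionalEquality using (_≡_)
open import Relation.Binary.Structures using (IsPartialOrder)

module _ {C : Set} (_≤_ : C → C → Set) where

  Directed : {I : Set} → (I → C) → Set
  Directed {I} F = I × (∀ i j → Σ I λ k → (F i ≤ F k) × (F j ≤ F k))

  IsLub : {I : Set} → (I → C) → C → Set
  IsLub {I} F s = (∀ i → F i ≤ s) × (∀ u → (∀ i → F i ≤ u) → s ≤ u)

Pointwise : {X C : Set} → (C → C → Set) → (X → C) → (X → C) → Set
Pointwise _≤_ f g = ∀ x → f x ≤ g x

Componentwise : {C : Set} → (C → C → Set) → (C × C) → (C × C) → Set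
Componentwise _≤_ p q = (proj₁ p ≤ proj₁ q) × (proj₂ p ≤ proj₂ q)

record CompletelyOrderedMonad : Set₁ where
  field
    T   : Set → Set
    η   : ∀ {X} → X → T X
    _†  : ∀ {X Y} → (X → T Y) → T X → T Y
    †-η    : ∀ {X} (t : T X) → (η †) t ≡ t
    †-∘-η  : ∀ {X Y} (f : X → T Y) (x : X) → (f †) (η x) ≡ f x
    †-assoc : ∀ {X Y Z} (f : X → T Y) (g : Y → T Z) (t : T X)
            → (((g †) ∘ f) †) t ≡ (g †) ((f †) t)
    _⊑_ : ∀ {X} → T X → T X → Set
    ⊑-isPartialOrder : ∀ {X} → IsPartialOrder (_≡_ {A = T X}) _⊑_
    bot     : ∀ {X Y} → X → T Y
    bot-least : ∀ {X Y} (f : X → T Y) → Pointwise _⊑_ bot f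
    dcpo : ∀ {X Y} {I : Set} (F : I → (X → T Y))
         → Directed (Pointwise _⊑_) F
         → Σ (X → T Y) λ s → IsLub (Pointwise _⊑_) F s
    ∘-join-left : ∀ {X Y Z} {I : Set} (F : I → (X → T Y)) (s : X → T Y)
                  (g : Y → T Z)
                → Directed (Pointwise _⊑_) F → IsLub (Pointwise _⊑_) F s
                → IsLub (Pointwise _⊑_) (λ i → (g †) ∘ F i) ((g †) ∘ s)
    ∘-join-right : ∀ {X Y Z} {I : Set} (G : I → (Y → T Z)) (s : Y → T Z)
                   (f : X → T Y)
                 → Directed (Pointwise _⊑_) G → IsLub (Pointwise _⊑_) G s
                 → IsLub (Pointwise _⊑_) (λ i → (G i †) ∘ f) ((s †) ∘ f)

  Tmap : ∀ {X Y} → (X → Y) → T X → T Y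
  Tmap v = (η ∘ v) †

record ContinuousOperation (M : CompletelyOrderedMonad) : Set₁ where
  open CompletelyOrderedMonad M
  field
    _⊕_ : ∀ {X} → T X → T X → T X
    ⊕-natural : ∀ {X Y} (v : X → Y) (s t : T X)
              → Tmap v (s ⊕ t) ≡ Tmap v s ⊕ Tmap v t
    ⊕-continuous : ∀ {X} {I : Set} (F : I → T X × T X) (s : T X × T X)
                 → Directed (Componentwise _⊑_) F
                 → IsLub (Componentwise _⊑_) F s
                 → IsLub _⊑_ (λ i → uncurry _⊕_ (F i)) (uncurry _⊕_ s)

-- Observation patterns: B ⊆ 𝒫(A*) closed under derivatives.
-- Languages b ⊆ A* are represented by characteristic functions List A → Bool.

_/_ : {A : Set} → (List A → Bool) → A → (List A → Bool)
(b / a) w = b (a ∷ w)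

record ObservationPattern (A : Set) : Set₁ where
  field
    B      : (List A → Bool) → Set
    closed : ∀ {b} → B b → ∀ a → B (b / a)

  Elem : Set
  Elem = Σ (List A → Bool) B

module _ (M : CompletelyOrderedMonad) where
  open CompletelyOrderedMonad M

  IsCoalgebraMorphism : {A X Y : Set} → (X → T (X × A)) → (Y → T (Y × A))
                      → (X → Y) → Set
  IsCoalgebraMorphism f g h =
    ∀ x → g (h x) ≡ Tmap (λ p → (h (proj₁ p) , proj₂ p)) (f x)

  module _ (O : ContinuousOperation M) {A : Set} (P : ObservationPattern A)
           {X Y : Set} (f : X → T (X × A)) (h : X → Y) where
    open ContinuousOperation O
    open ObservationPattern P

    e : Elem → X → T Y
    e (b , _) x = if b [] then η (h x) else bot x

    Step : (X → Elem → T Y) → X → Elem → T Y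
    Step k x (b , pb) =
      e (b , pb) x ⊕ ((λ p → k (proj₁ p) (b / proj₂ p , closed pb (proj₂ p))) †) (f x)

    SatisfiesEquation : (X → Elem → T Y) → Set
    SatisfiesEquation k = ∀ x β → k x β ≡ Step k x β

    -- k is f^B_h: the least map (pointwise order) satisfying the equation
    IsSemantics : (X → Elem → T Y) → Set
    IsSemantics k = SatisfiesEquation k
                  × (∀ k' → SatisfiesEquation k' → ∀ x β → k x β ⊑ k' x β)

Ker : {X E C : Set} → (X → E → C) → X → X → Set
Ker k x x' = ∀ β → k x β ≡ k x' β

Ker₀ : {X C : Set} → (X → C) → X → X → Set
Ker₀ h x x' = h x ≡ h x'

-- The semantics of the target coalgebra, viewed as a map
-- μΦ : Y × B → T Y, is built by Kleene iteration of the operator Φ whose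
-- fixed points are the solutions of the defining equation for g^B_id.
-- Because h is a coalgebra morphism, the defining operator of f^B_h on
-- maps of the form K ∘ (h × id) agrees with Φ K ∘ (h × id).  Hence
-- μΦ ∘ (h × id) solves the equation for f^B_h (so f^B_h lies below it),
-- and every Kleene iterate of Φ, precomposed with h × id, lies below f^B_h
-- (so the join μΦ ∘ (h × id) does too).  Thus f^B_h(x)(β) = μΦ(h x , β),
-- which depends on x only through h x.
module Submission where

open import Defs
open import Data.Product using (_×_; _,_; proj₁; proj₂; curry)
open import Data.Bool using (Bool; true; false)
open import Data.Unit using (⊤; tt)
open import Data.List using ([])
open import Data.Nat using (ℕ; zero; suc; _≤′_; ≤′-refl; ≤′-step; _⊔_)
open import Data.Nat.Properties using (≤⇒≤′; m≤m⊔n; m≤n⊔m)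
open import Function using (_∘_; id)
open import Relation.Binary.PropositionalEquality
  using (_≡_; refl; sym; trans; cong; cong₂; subst; subst₂; module ≡-Reasoning)
open import Relation.Binary.Structures using (IsPartialOrder)

-- Least upper bounds are unique up to any relation E implied by
-- antisymmetry (E is ≡ for elements, pointwise ≡ for maps).
lub-unique : ∀ {C I : Set} {R E : C → C → Set} {F : I → C} {s s' : C}
           → (∀ {a b} → R a b → R b a → E a b)
           → IsLub R F s → IsLub R F s' → E s s'
lub-unique antisym (upper , least) (upper' , least') =
  antisym (least _ upper') (least' _ upper)

lub-resp : ∀ {C I : Set} {R : C → C → Set} {F G : I → C} {s t : C}
         → (∀ i → F i ≡ G i) → s ≡ t → IsLub R F s → IsLub R G t
lub-resp {R = R} F≡G refl (upper , least) =
  (λ i → subst (λ a → R a _) (F≡G i) (upper i))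
  , λ u ub → least u (λ i → subst (λ a → R a u) (sym (F≡G i)) (ub i))

pointwise-lub : ∀ {Z C I : Set} {R : C → C → Set} {F : I → Z → C} {s : Z → C}
              → (∀ z → IsLub R (λ i → F i z) (s z))
              → IsLub (Pointwise R) F s
pointwise-lub lubs =
  (λ i z → proj₁ (lubs z) i)
  , λ u ub z → proj₂ (lubs z) (u z) (λ i → ub i z)

module Chains {C : Set} (R : C → C → Set)
              (R-refl : ∀ {a} → R a a)
              (R-trans : ∀ {a b c} → R a b → R b c → R a c) where

  Ascending : (ℕ → C) → Set
  Ascending F = ∀ n → R (F n) (F (suc n))

  ascending-mono : ∀ {F} → Ascending F → ∀ {m n} → m ≤′ n → R (F m) (F n)
  ascending-mono asc ≤′-refl = R-refl
  ascending-mono asc (≤′-step m≤′n) = R-trans (ascending-mono asc m≤′n) (asc _)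

  ascending⇒directed : ∀ {F} → Ascending F → Directed R F
  ascending⇒directed asc =
    zero , λ i j → i ⊔ j , ascending-mono asc (≤⇒≤′ (m≤m⊔n i j))
                         , ascending-mono asc (≤⇒≤′ (m≤n⊔m i j))

  lub-shift : ∀ {F s} → Ascending F → IsLub R F s → IsLub R (F ∘ suc) s
  lub-shift asc (upper , least) =
    (λ i → upper (suc i))
    , λ u ub → least u λ { zero → R-trans (asc zero) (ub zero)
                         ; (suc i) → ub i }

module MonadFacts (M : CompletelyOrderedMonad) where
  open CompletelyOrderedMonad M public

  module ⊑ {W : Set} = IsPartialOrder (⊑-isPartialOrder {W})

  _≤ₚ_ : ∀ {Z V} → (Z → T V) → (Z → T V) → Set
  _≤ₚ_ = Pointwise _⊑_

  ≤ₚ-refl : ∀ {Z V} {K : Z → T V} → K ≤ₚ K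
  ≤ₚ-refl z = ⊑.refl

  ≤ₚ-trans : ∀ {Z V} {K K' K'' : Z → T V} → K ≤ₚ K' → K' ≤ₚ K'' → K ≤ₚ K''
  ≤ₚ-trans p q z = ⊑.trans (p z) (q z)

  ≤ₚ-antisym : ∀ {Z V} {K K' : Z → T V} → K ≤ₚ K' → K' ≤ₚ K → ∀ z → K z ≡ K' z
  ≤ₚ-antisym p q z = ⊑.antisym (p z) (q z)

  module PointwiseChains {Z V : Set} =
    Chains (_≤ₚ_ {Z} {V}) ≤ₚ-refl ≤ₚ-trans

  bot-constant : ∀ {Z Z' V} (z : Z) (z' : Z') → bot {Z} {V} z ≡ bot {Z'} {V} z'
  bot-constant z z' =
    ⊑.antisym (bot-least (λ _ → bot z') z) (bot-least (λ _ → bot z) z')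

  -- Kleisli extension is monotone: apply continuity in the left argument
  -- to the directed two-element family {F , G} with join G.
  †-mono : ∀ {U V} {F G : U → T V} → F ≤ₚ G → ∀ t → (F †) t ⊑ (G †) t
  †-mono {F = F} {G} F≤G t =
    proj₁ (∘-join-right pair G (λ (t' : T _) → t') directed lub) false t
    where
      pair : Bool → _
      pair true = G
      pair false = F
      below : ∀ i → pair i ≤ₚ G
      below true = ≤ₚ-refl
      below false = F≤G
      directed : Directed _≤ₚ_ pair
      directed = true , λ i j → true , below i , below j
      lub : IsLub _≤ₚ_ pair G
      lub = below , λ u ub → ub true

  †-cong : ∀ {U V} {F G : U → T V} → (∀ a → F a ≡ G a) → ∀ t → (F †) t ≡ (G †) t
  †-cong F≡G t = ⊑.antisym (†-mono (λ a → ⊑.reflexive (F≡G a)) t)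
                           (†-mono (λ a → ⊑.reflexive (sym (F≡G a))) t)

  †-Tmap : ∀ {U U' V} (G : U' → T V) (ψ : U → U') (t : T U)
         → (G †) (Tmap ψ t) ≡ ((G ∘ ψ) †) t
  †-Tmap G ψ t = begin
    (G †) (((η ∘ ψ) †) t)      ≡⟨ sym (†-assoc (η ∘ ψ) G t) ⟩
    (((G †) ∘ η ∘ ψ) †) t      ≡⟨ †-cong (λ a → †-∘-η G (ψ a)) t ⟩
    ((G ∘ ψ) †) t              ∎
    where open ≡-Reasoning

  †-continuous : ∀ {U V I} {G : I → U → T V} {s : U → T V}
               → Directed _≤ₚ_ G → IsLub _≤ₚ_ G s
               → ∀ t → IsLub _⊑_ (λ i → (G i †) t) ((s †) t)
  †-continuous {G = G} {s} directed lub t =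
    (λ i → proj₁ L i tt) , λ u ub → proj₂ L (λ _ → u) (λ i _ → ub i) tt
    where L = ∘-join-right G s (λ (_ : ⊤) → t) directed lub

  -- Directed joins of maps are computed pointwise (evaluate at η z).
  lub-eval : ∀ {Z V I} {F : I → Z → T V} {s : Z → T V}
           → Directed _≤ₚ_ F → IsLub _≤ₚ_ F s
           → ∀ z → IsLub _⊑_ (λ i → F i z) (s z)
  lub-eval {F = F} {s} directed lub z =
    lub-resp {R = _⊑_} (λ i → †-∘-η (F i) z) (†-∘-η s z) (†-continuous directed lub (η z))

  module Kleene {Z V : Set} (Φ : (Z → T V) → Z → T V)
                (Φ-mono : ∀ {K K'} → K ≤ₚ K' → Φ K ≤ₚ Φ K')
                (Φ-continuous : ∀ {F s} → PointwiseChains.Ascending F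
                              → IsLub _≤ₚ_ F s → IsLub _≤ₚ_ (Φ ∘ F) (Φ s))
                where
    open PointwiseChains

    iterate : ℕ → Z → T V
    iterate zero = bot
    iterate (suc n) = Φ (iterate n)

    iterate-ascending : Ascending iterate
    iterate-ascending zero = bot-least (iterate 1)
    iterate-ascending (suc n) = Φ-mono (iterate-ascending n)

    μΦ : Z → T V
    μΦ = proj₁ (dcpo iterate (ascending⇒directed iterate-ascending))

    μΦ-lub : IsLub _≤ₚ_ iterate μΦ
    μΦ-lub = proj₂ (dcpo iterate (ascending⇒directed iterate-ascending))

    -- μΦ is the join both of (Φⁿ⁺¹ ⊥)ₙ and, by continuity, of (Φ Φⁿ ⊥)ₙ.
    μΦ-fixed : ∀ z → μΦ z ≡ Φ μΦ z
    μΦ-fixed = lub-unique {R = _≤ₚ_} ≤ₚ-antisym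
      (lub-shift iterate-ascending μΦ-lub)
      (Φ-continuous iterate-ascending μΦ-lub)

module OperationFacts (M : CompletelyOrderedMonad) (O : ContinuousOperation M) where
  open MonadFacts M
  open ContinuousOperation O public

  module ⊑Chains {V : Set} = Chains (_⊑_ {V}) ⊑.refl ⊑.trans

  module ComponentwiseChains {V : Set} =
    Chains (Componentwise (_⊑_ {V})) (⊑.refl , ⊑.refl)
           (λ p q → ⊑.trans (proj₁ p) (proj₁ q) , ⊑.trans (proj₂ p) (proj₂ q))

  -- ⊕ is monotone: continuity applied to the directed family
  -- {(a , b) , (a' , b')} with join (a' , b').
  ⊕-mono : ∀ {V} {a a' b b' : T V} → a ⊑ a' → b ⊑ b' → (a ⊕ b) ⊑ (a' ⊕ b')
  ⊕-mono {a = a} {a'} {b} {b'} a⊑a' b⊑b' =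
    proj₁ (⊕-continuous pair (a' , b') directed lub) false
    where
      pair : Bool → _
      pair true = a' , b'
      pair false = a , b
      below : ∀ i → Componentwise _⊑_ (pair i) (a' , b')
      below true = ⊑.refl , ⊑.refl
      below false = a⊑a' , b⊑b'
      directed : Directed (Componentwise _⊑_) pair
      directed = true , λ i j → true , below i , below j
      lub : IsLub (Componentwise _⊑_) pair (a' , b')
      lub = below , λ u ub → ub true

  ⊕-continuousʳ : ∀ {V} {a : T V} {F : ℕ → T V} {s : T V}
                → ⊑Chains.Ascending F → IsLub _⊑_ F s
                → IsLub _⊑_ (λ i → a ⊕ F i) (a ⊕ s)
  ⊕-continuousʳ {a = a} {F} {s} asc (upper , least) =
    ⊕-continuous (λ i → a , F i) (a , s)
      (ComponentwiseChains.ascending⇒directed (λ n → ⊑.refl , asc n))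
      ((λ i → ⊑.refl , upper i)
      , λ u ub → proj₁ (ub zero) , least (proj₂ u) (λ i → proj₂ (ub i)))

module CoalgebraSemantics (M : CompletelyOrderedMonad) (O : ContinuousOperation M)
                          {A : Set} (P : ObservationPattern A) where
  open MonadFacts M
  open OperationFacts M O
  open ObservationPattern P

  successor : ∀ {Y : Set} → Elem → Y × A → Y × Elem
  successor (b , b∈B) (y , a) = y , (b / a , closed b∈B a)

  Step-morphism : ∀ {X Y W} {f : X → T (X × A)} {g : Y → T (Y × A)} {h : X → Y}
                → IsCoalgebraMorphism M f g h
                → (j : Y → W) (K : Y → Elem → T W) (x : X) (β : Elem)
                → Step M O P g j K (h x) β ≡ Step M O P f (j ∘ h) (K ∘ h) x β
  Step-morphism {X} {Y} {W} {f} {g} {h} hom j K x (b , b∈B) =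
    cong₂ _⊕_ observation continuation
    where
      observation : e M O P g j (b , b∈B) (h x) ≡ e M O P f (j ∘ h) (b , b∈B) x
      observation with b []
      ... | true = refl
      ... | false = bot-constant (h x) x
      G : Y × A → T W
      G p = K (proj₁ p) (b / proj₂ p , closed b∈B (proj₂ p))
      continuation : (G †) (g (h x)) ≡ ((G ∘ λ p → h (proj₁ p) , proj₂ p) †) (f x)
      continuation = trans (cong (G †) (hom x)) (†-Tmap G _ (f x))

  module Operator {Y : Set} (g : Y → T (Y × A)) where
    open PointwiseChains

    Φ : (Y × Elem → T Y) → Y × Elem → T Y
    Φ K (y , β) = Step M O P g id (curry K) y β

    Φ-mono : ∀ {K K'} → K ≤ₚ K' → Φ K ≤ₚ Φ K'
    Φ-mono K≤K' (y , β) = ⊕-mono ⊑.refl (†-mono (K≤K' ∘ successor β) (g y))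

    Φ-continuous : ∀ {F s} → Ascending F → IsLub _≤ₚ_ F s → IsLub _≤ₚ_ (Φ ∘ F) (Φ s)
    Φ-continuous {F} {s} asc lub = pointwise-lub {R = _⊑_} λ { (y , β) →
      ⊕-continuousʳ (λ n → †-mono (asc n ∘ successor β) (g y))
        (†-continuous (ascending⇒directed (λ n → asc n ∘ successor β))
                      (pointwise-lub {R = _⊑_} (lub-eval (ascending⇒directed asc) lub ∘ successor β))
                      (g y)) }

    open Kleene Φ Φ-mono Φ-continuous public

module Factorisation (M : CompletelyOrderedMonad) (O : ContinuousOperation M)
    {A : Set} (P : ObservationPattern A) {X Y : Set}
    (f : X → CompletelyOrderedMonad.T M (X × A))
    (g : Y → CompletelyOrderedMonad.T M (Y × A))
    (h : X → Y) (hom : IsCoalgebraMorphism M f g h)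
    (k : X → ObservationPattern.Elem P → CompletelyOrderedMonad.T M Y)
    (sem : IsSemantics M O P f h k) where
  open MonadFacts M
  open OperationFacts M O using (⊕-mono)
  open ObservationPattern P using (Elem)
  open CoalgebraSemantics M O P
  open Operator g

  μΦ∘h-solves : SatisfiesEquation M O P f h (λ x β → μΦ (h x , β))
  μΦ∘h-solves x β = trans (μΦ-fixed (h x , β)) (Step-morphism {g = g} hom id (curry μΦ) x β)

  iterate-below : ∀ n x β → iterate n (h x , β) ⊑ k x β
  iterate-below zero x β = bot-least (λ _ → k x β) (h x , β)
  iterate-below (suc n) x β =
    subst₂ _⊑_ (sym (Step-morphism {g = g} hom id (curry (iterate n)) x β))
               (sym (proj₁ sem x β))
               (⊕-mono ⊑.refl (†-mono below-successor (f x)))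
    where
      below-successor : ∀ p → iterate n (h (proj₁ p) , proj₂ (successor β p))
                            ⊑ k (proj₁ p) (proj₂ (successor β p))
      below-successor (x' , a) = iterate-below n x' (proj₂ (successor β (x' , a)))

  factorises : ∀ x β → k x β ≡ μΦ (h x , β)
  factorises x β = ⊑.antisym
    (proj₂ sem _ μΦ∘h-solves x β)
    (proj₂ (lub-eval (PointwiseChains.ascending⇒directed iterate-ascending) μΦ-lub (h x , β))
           (k x β) (λ n → iterate-below n x β))

corollary15 : (M : CompletelyOrderedMonad) (O : ContinuousOperation M)
    {A : Set} (P : ObservationPattern A) {X Y : Set}
    (f : X → CompletelyOrderedMonad.T M (X × A))
    (g : Y → CompletelyOrderedMonad.T M (Y × A))
    (h : X → Y)
    → IsCoalgebraMorphism M f g h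
    → (k : X → ObservationPattern.Elem P → CompletelyOrderedMonad.T M Y)
    → IsSemantics M O P f h k
    → ∀ x x' → Ker₀ h x x' → Ker k x x'
corollary15 M O P f g h hom k sem x x' hx≡hx' β = begin
  k x β           ≡⟨ factorises x β ⟩
  μΦ (h x , β)    ≡⟨ cong (λ y → μΦ (y , β)) hx≡hx' ⟩
  μΦ (h x' , β)   ≡⟨ sym (factorises x' β) ⟩
  k x' β          ∎
  where
    open Factorisation M O P f g h hom k sem
    open CoalgebraSemantics.Operator M O P g using (μΦ)
    open ≡-Reasoning
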